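{- Let $n\ge t\ge 2$ and let $X=X_1\sqcup\cdots\sqcup X_{t-1}$ be a partition of an $n$-element set $X$ into $t-1$ parts with $|X_i|\in\{\lfloor\frac{n}{t-1}\rfloor,\lceil\frac{n}{t-1}\rceil\}$ for all $i$. Then $$s(n,t)>\prod_{i=1}^{t-1}(|X_i|+1)>\left(\frac{n}{t-1}\right)^{t-1}.$$ Consequently, for every positive integer $k\le\frac n2$, $$p(n,k)\ge s(n,2k)>\left(\frac{n}{2k-1}\right)^{2k-1}.$$
   Context: A family $\mathcal{F}\subset 2^X$ is called $t$-separable if there is a $t$-element subset $T\subset X$ such that for every ordered pair $x,y\in T$ with $x\neq y$ there exists $F\in\mathcal{F}$ with $F\cap\{x,y\}=\{x\}$. $s(n,t)$ is the smallest number $s$ such that every family of at least $s$ subsets of an $n$-element set is $t$-separable. A matching of size $k$ is a collection $\{x_1,x_2\},\ldots,\{x_{2k-1},x_{2k}\}$ of $k$ pairwise disjoint 2-element subsets; a snake is a set obtained by choosing one element from each pair; the matching is shattered by $\mathcal{F}$ if for every snake $S$ there is $F\in\mathcal{F}$ with $F\cap\{x_1,\ldots,x_{2k}\}=S$. $p(n,k)$ is the smallest number $p$ such that every family of at least $p$ subsets of an $n$-element set shatters some matching of size $k$. -}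

module Defs where

open import Data.Nat using (ℕ; zero; suc; _+_; _*_; _∸_; _^_; _≤_; _<_)
open import Data.Nat.DivMod using (_/_)
open import Data.Bool using (Bool)
open import Data.Fin using (Fin)
open import Data.Fin.Subset using (Subset; ∣_∣) renaming (_∈_ to _∈ₛ_; _∉_ to _∉ₛ_)
open import Data.List using (List; length; map; allFin)
open import Data.Nat.ListAction using (product)
open import Data.List.Membership.Propositional using (_∈_)
open import Data.List.Relation.Unary.Unique.Propositional using (Unique)
open import Data.Vec using (tabulate)
open import Data.Product using (Σ; ∃; _×_)
open import Relation.Binary.PropositionalEquality using (_≡_; _≢_)
open import Relation.Nullary using (¬_)
open import Relation.Nullary.Decidable using (⌊_⌋)
open import Data.Fin using (_≟_)

-- A family of subsets of the n-element set X = Fin n is a duplicate-free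
-- list of subsets; its size is the length of the list.

Separable : {n : ℕ} → ℕ → List (Subset n) → Set
Separable {n} t 𝓕 =
  Σ (Subset n) λ T → ∣ T ∣ ≡ t ×
    ((x y : Fin n) → x ∈ₛ T → y ∈ₛ T → x ≢ y →
      Σ (Subset n) λ F → F ∈ 𝓕 × x ∈ₛ F × y ∉ₛ F)

AllSeparable : ℕ → ℕ → ℕ → Set
AllSeparable n t s =
  (𝓕 : List (Subset n)) → Unique 𝓕 → s ≤ length 𝓕 → Separable t 𝓕

IsS : ℕ → ℕ → ℕ → Set
IsS n t s = AllSeparable n t s × ((s' : ℕ) → AllSeparable n t s' → s ≤ s')

-- 𝓕 shatters some matching of size k: f i false, f i true are the two
-- elements of the i-th pair (all 2k elements distinct); for every snake
-- (choice c i of one element from each pair) some F ∈ 𝓕 meets the 2k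
-- matched elements exactly in the snake.
Shatters : {n : ℕ} → ℕ → List (Subset n) → Set
Shatters {n} k 𝓕 =
  Σ (Fin k → Bool → Fin n) λ f →
    ((i j : Fin k) (b c : Bool) → f i b ≡ f j c → (i ≡ j × b ≡ c)) ×
    ((c : Fin k → Bool) →
      Σ (Subset n) λ F → F ∈ 𝓕 ×
        ((i : Fin k) (b : Bool) →
          (b ≡ c i → f i b ∈ₛ F) × (¬ (b ≡ c i) → f i b ∉ₛ F)))

AllShatter : ℕ → ℕ → ℕ → Set
AllShatter n k p =
  (𝓕 : List (Subset n)) → Unique 𝓕 → p ≤ length 𝓕 → Shatters k 𝓕

IsP : ℕ → ℕ → ℕ → Set
IsP n k p = AllShatter n k p × ((p' : ℕ) → AllShatter n k p' → p ≤ p')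

⌈_/suc_⌉ : ℕ → ℕ → ℕ
⌈ n /suc d ⌉ = (n + d) / suc d

part : {n r : ℕ} → (Fin n → Fin r) → Fin r → Subset n
part π i = tabulate (λ x → ⌊ π x ≟ i ⌋)

partProduct : {n r : ℕ} → (Fin n → Fin r) → ℕ
partProduct {n} {r} π = product (map (λ i → ∣ part π i ∣ + 1) (allFin r))

-- Let π split X = Fin n into the t − 1 parts X_i.  The sets whose trace on every
-- part is an upper segment of that part (in the order of Fin n) form a family of
-- size ∏ (|X_i| + 1), and it separates no t-set T: two elements x < y of T lie
-- in a common part, so every member containing x contains y.  Parts of size at
-- least ⌊n/(t−1)⌋ satisfy n < (|X_i| + 1)(t − 1), which multiplies up to the
-- power bound.  A shattered k-matching separates its 2k vertices, so
-- s(n,2k) ≤ p(n,k), and the residue classes modulo 2k − 1 are such a partition.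
module Submission where

open import Defs
open import Data.Nat using (ℕ; zero; suc; _+_; _*_; _∸_; _^_; _≤_; _<_; z≤n; s≤s; NonZero)
open import Data.Nat.Properties
  using (≤-refl; ≤-reflexive; m≤m+n; ≤-trans; <⇒≤; <-≤-trans; n<1+n; ≰⇒>; +-comm; +-monoˡ-<; +-monoʳ-≤;
         +-cancelˡ-≡; *-comm; *-monoˡ-≤; *-monoʳ-≤; *-mono-<; *-cancelʳ-≡; *-identityʳ;
         *-distribˡ-+; *-distribʳ-+; module ≤-Reasoning)
open import Data.Nat.DivMod
  using (_/_; _%_; _mod_; m≡m%n+[m/n]*n; m%n<n; m/n*n≤m; [m+kn]%n≡m%n; m<n⇒m%n≡m; /-monoˡ-≤)
open import Data.Nat.ListAction using (product)
open import Data.Nat.Tactic.RingSolver using (solve-∀)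
open import Data.Bool using (Bool; true; false; not; if_then_else_)
open import Data.Bool.Properties using (not-¬)
open import Data.Fin as Fin using (Fin; zero; suc; toℕ; fromℕ<; _≟_)
open import Data.Fin.Properties using (suc-injective; toℕ-injective; toℕ-fromℕ<; toℕ<n; pigeonhole; <⇒≢)
open import Data.Fin.Subset using (Subset; ∣_∣; inside; outside; ⁅_⁆; _∪_; ⊥)
  renaming (_∈_ to _∈ₛ_; _∉_ to _∉ₛ_)
open import Data.Fin.Subset.Properties using (∉⊥; ∣⊥∣≡0; x∈⁅y⁆⇒x≡y; x∈p∪q⁻; ∪-identityˡ; p⊆q⇒∣p∣≤∣q∣)
open import Data.Vec using (_∷_; []; here; there)
open import Data.Vec.Properties using (∷-injectiveʳ; lookup⇒[]=; lookup∘tabulate)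
open import Data.Vec.Functional using (updateAt)
open import Data.Vec.Functional.Properties using (updateAt-updates; updateAt-minimal)
open import Data.List using (List; []; _∷_; map; _++_; foldr; length; tabulate; allFin; cartesianProductWith)
open import Data.List.Properties using (length-map; length-++; length-tabulate; map-tabulate)
open import Data.List.Membership.Propositional using (_∈_)
open import Data.List.Membership.Propositional.Properties using (∈-map⁻; ∈-++⁻; ∈-tabulate⁻; ∈-cartesianProductWith⁻)
open import Data.List.Relation.Unary.Any using (here; there)
open import Data.List.Relation.Unary.AllPairs using ([]; _∷_)
open import Data.List.Relation.Unary.All using ([]; _∷_)
open import Data.List.Relation.Unary.Unique.Propositional using (Unique)
open import Data.List.Relation.Unary.Unique.Propositional.Properties
  using (map⁺; ++⁺; tabulate⁺; allFin⁺; cartesianProductWith⁺; Unique[x∷xs]⇒x∉xs)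
open import Data.Product using (Σ; _×_; _,_; proj₁; proj₂)
open import Data.Sum using (_⊎_; inj₁; inj₂)
open import Data.Empty using (⊥-elim)
open import Function using (_∘_; id; const)
open import Relation.Binary.PropositionalEquality
open import Relation.Nullary using (¬_; Dec; yes; no; contradiction)
open import Relation.Nullary.Decidable using (⌊_⌋)

private
  variable
    n r : ℕ

∏ : (Fin r → ℕ) → ℕ
∏ f = product (tabulate f)

∏-cong : {f g : Fin r → ℕ} → (∀ i → f i ≡ g i) → ∏ f ≡ ∏ g
∏-cong {zero}  _ = refl
∏-cong {suc r} f≗g = cong₂ _*_ (f≗g zero) (∏-cong (f≗g ∘ suc))

∏-ones : {f : Fin r → ℕ} → (∀ i → f i ≡ 1) → ∏ f ≡ 1
∏-ones {zero}  _ = refl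
∏-ones {suc r} f≗1 = cong₂ _*_ (f≗1 zero) (∏-ones (f≗1 ∘ suc))

∏-additive : {f g h : Fin r → ℕ} (p : Fin r) → f p ≡ g p + h p →
             (∀ i → i ≢ p → g i ≡ f i × h i ≡ f i) → ∏ f ≡ ∏ g + ∏ h
∏-additive {f = f} {g} {h} zero fp≡gp+hp elsewhere = begin
  f zero * ∏ (f ∘ suc)                          ≡⟨ cong (_* ∏ (f ∘ suc)) fp≡gp+hp ⟩
  (g zero + h zero) * ∏ (f ∘ suc)               ≡⟨ *-distribʳ-+ (∏ (f ∘ suc)) (g zero) (h zero) ⟩
  g zero * ∏ (f ∘ suc) + h zero * ∏ (f ∘ suc)   ≡⟨ cong₂ _+_ (cong (g zero *_) (∏-cong (proj₁ ∘ tail)))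
                                                              (cong (h zero *_) (∏-cong (proj₂ ∘ tail))) ⟨
  ∏ g + ∏ h                                     ∎
  where
  open ≡-Reasoning
  tail : ∀ i → g (suc i) ≡ f (suc i) × h (suc i) ≡ f (suc i)
  tail i = elsewhere (suc i) λ ()
∏-additive {f = f} {g} {h} (suc p) fp≡gp+hp elsewhere = begin
  f zero * ∏ (f ∘ suc)                          ≡⟨ cong (f zero *_) (∏-additive p fp≡gp+hp tail) ⟩
  f zero * (∏ (g ∘ suc) + ∏ (h ∘ suc))          ≡⟨ *-distribˡ-+ (f zero) (∏ (g ∘ suc)) (∏ (h ∘ suc)) ⟩
  f zero * ∏ (g ∘ suc) + f zero * ∏ (h ∘ suc)   ≡⟨ cong₂ _+_ (cong (_* ∏ (g ∘ suc)) (proj₁ head))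
                                                              (cong (_* ∏ (h ∘ suc)) (proj₂ head)) ⟨
  ∏ g + ∏ h                                     ∎
  where
  open ≡-Reasoning
  head : g zero ≡ f zero × h zero ≡ f zero
  head = elsewhere zero λ ()
  tail : ∀ i → i ≢ p → g (suc i) ≡ f (suc i) × h (suc i) ≡ f (suc i)
  tail i i≢p = elsewhere (suc i) (i≢p ∘ suc-injective)

^<∏*^ : ∀ {a c} (f : Fin (suc r) → ℕ) → (∀ i → a < f i * c) → a ^ suc r < ∏ f * c ^ suc r
^<∏*^ {zero} {a} {c} f a<fc
  rewrite *-identityʳ a | *-identityʳ (f zero) | *-identityʳ c = a<fc zero
^<∏*^ {suc r} {a} {c} f a<fc =
  subst (a * a ^ suc r <_) (interchange (f zero) c (∏ (f ∘ suc)) (c ^ suc r))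
        (*-mono-< (a<fc zero) (^<∏*^ (f ∘ suc) (a<fc ∘ suc)))
  where
  interchange : ∀ w x y z → (w * x) * (y * z) ≡ (w * y) * (x * z)
  interchange = solve-∀

m/n≤o⇒m<[o+1]*n : ∀ m d .{{_ : NonZero d}} {o} → m / d ≤ o → m < (o + 1) * d
m/n≤o⇒m<[o+1]*n m d {o} m/d≤o = begin-strict
  m                   ≡⟨ m≡m%n+[m/n]*n m d ⟩
  m % d + (m / d) * d <⟨ +-monoˡ-< ((m / d) * d) (m%n<n m d) ⟩
  d + (m / d) * d     ≤⟨ +-monoʳ-≤ d (*-monoˡ-≤ d m/d≤o) ⟩
  d + o * d           ≡⟨ cong (_* d) (+-comm 1 o) ⟩
  (o + 1) * d         ∎
  where open ≤-Reasoning

UpClosed : (Fin n → Fin r) → Subset n → Set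
UpClosed π F = ∀ {x y} → x Fin.< y → π x ≡ π y → x ∈ₛ F → y ∈ₛ F

Covers : (Fin n → Fin r) → (Fin r → Bool) → Subset n → Set
Covers π started F = ∀ x → started (π x) ≡ true → x ∈ₛ F

start : (Fin r → Bool) → Fin r → Fin r → Bool
start started p = updateAt started p (const true)

start-mono : (started : Fin r → Bool) (p : Fin r) {i : Fin r} →
             started i ≡ true → start started p i ≡ true
start-mono started p {i} started-i with i ≟ p
... | yes refl = updateAt-updates p started
... | no i≢p   = trans (updateAt-minimal i p started i≢p) started-i

-- Its members are the sets whose trace on every part is an upper segment and
-- which contain all of each part already marked as started.
suffixFamily : (n : ℕ) → (Fin n → Fin r) → (Fin r → Bool) → List (Subset n)
suffixFamily zero    π started = [] ∷ []
suffixFamily (suc n) π started with started (π zero)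
... | true  = map (inside ∷_) (suffixFamily n (π ∘ suc) started)
... | false = map (outside ∷_) (suffixFamily n (π ∘ suc) started)
           ++ map (inside ∷_) (suffixFamily n (π ∘ suc) (start started (π zero)))

suffixFamily-unique : (n : ℕ) (π : Fin n → Fin r) (started : Fin r → Bool) →
                      Unique (suffixFamily n π started)
suffixFamily-unique zero    π started = [] ∷ []
suffixFamily-unique (suc n) π started with started (π zero)
... | true  = map⁺ ∷-injectiveʳ (suffixFamily-unique n (π ∘ suc) started)
... | false = ++⁺ (map⁺ ∷-injectiveʳ (suffixFamily-unique n (π ∘ suc) started))
                  (map⁺ ∷-injectiveʳ (suffixFamily-unique n (π ∘ suc) _))
                  outside≢inside
  where
  outside≢inside : ∀ {F} → ¬ (F ∈ map (outside ∷_) _ × F ∈ map (inside ∷_) _)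
  outside≢inside (F∈ˡ , F∈ʳ) with ∈-map⁻ (outside ∷_) F∈ˡ | ∈-map⁻ (inside ∷_) F∈ʳ
  ... | _ , _ , refl | _ , _ , ()

∷-upClosed : {π : Fin (suc n) → Fin r} {b : Bool} {F : Subset n} →
             (b ≡ inside → ∀ y → π (suc y) ≡ π zero → y ∈ₛ F) →
             UpClosed (π ∘ suc) F → UpClosed π (b ∷ F)
∷-upClosed head tail {zero}  {zero}  ()
∷-upClosed head tail {zero}  {suc y} _          πx≡πy here       = there (head refl y (sym πx≡πy))
∷-upClosed head tail {suc x} {zero}  ()
∷-upClosed head tail {suc x} {suc y} (s≤s x<y) πx≡πy (there x∈F) = there (tail x<y πx≡πy x∈F)

∷-covers : {π : Fin (suc n) → Fin r} {started started′ : Fin r → Bool} {b : Bool} {F : Subset n} →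
           (started (π zero) ≡ true → b ≡ inside) →
           (∀ {i} → started i ≡ true → started′ i ≡ true) →
           Covers (π ∘ suc) started′ F → Covers π started (b ∷ F)
∷-covers {F = F} head mono tail zero    started-πx = subst (λ b → zero ∈ₛ b ∷ F) (sym (head started-πx)) here
∷-covers         head mono tail (suc x) started-πx = there (tail x (mono started-πx))

suffixFamily-shape : (n : ℕ) (π : Fin n → Fin r) (started : Fin r → Bool) {F : Subset n} →
                     F ∈ suffixFamily n π started → UpClosed π F × Covers π started F
suffixFamily-shape zero π started {[]} _ = (λ { {()} }) , (λ ())
suffixFamily-shape (suc n) π started F∈ with started (π zero) in started-π0
... | true with ∈-map⁻ (inside ∷_) F∈
...   | G , G∈ , refl =
  let upClosed , covers = suffixFamily-shape n (π ∘ suc) started G∈ in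
  ∷-upClosed {π = π} (λ _ y πy≡π0 → covers y (trans (cong started πy≡π0) started-π0)) upClosed ,
  ∷-covers {π = π} {started = started} (const refl) id covers
suffixFamily-shape (suc n) π started F∈ | false with ∈-++⁻ (map (outside ∷_) (suffixFamily n (π ∘ suc) started)) F∈
... | inj₁ F∈ˡ with ∈-map⁻ (outside ∷_) F∈ˡ
...   | G , G∈ , refl =
  let upClosed , covers = suffixFamily-shape n (π ∘ suc) started G∈ in
  ∷-upClosed {π = π} (λ ()) upClosed ,
  ∷-covers {π = π} {started = started}
           (λ started-π0′ → contradiction (trans (sym started-π0) started-π0′) λ ()) id covers
suffixFamily-shape (suc n) π started F∈ | false | inj₂ F∈ʳ with ∈-map⁻ (inside ∷_) F∈ʳ
...   | G , G∈ , refl =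
  let upClosed , covers = suffixFamily-shape n (π ∘ suc) (start started (π zero)) G∈ in
  ∷-upClosed {π = π} (λ _ y πy≡π0 → covers y (subst (λ i → start started (π zero) i ≡ true) (sym πy≡π0)
                                             (updateAt-updates (π zero) started))) upClosed ,
  ∷-covers {π = π} {started = started} (const refl) (start-mono started (π zero)) covers

∣part∣-tail : (π : Fin (suc n) → Fin r) {i : Fin r} → i ≢ π zero → ∣ part π i ∣ ≡ ∣ part (π ∘ suc) i ∣
∣part∣-tail π {i} i≢π0 with π zero ≟ i
... | yes π0≡i = ⊥-elim (i≢π0 (sym π0≡i))
... | no _     = refl

∣part∣-head : (π : Fin (suc n) → Fin r) → ∣ part π (π zero) ∣ ≡ suc ∣ part (π ∘ suc) (π zero) ∣
∣part∣-head π with π zero ≟ π zero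
... | yes _     = refl
... | no π0≢π0 = ⊥-elim (π0≢π0 refl)

-- The number of admissible traces on what remains of part i.
traceCount : (Fin n → Fin r) → (Fin r → Bool) → Fin r → ℕ
traceCount π started i = if started i then 1 else ∣ part π i ∣ + 1

traceCount-tail : (π : Fin (suc n) → Fin r) (started : Fin r → Bool) {i : Fin r} →
                  i ≢ π zero → traceCount (π ∘ suc) started i ≡ traceCount π started i
traceCount-tail π started {i} i≢π0 =
  cong (λ k → if started i then 1 else k + 1) (sym (∣part∣-tail π i≢π0))

length-suffixFamily : (n : ℕ) (π : Fin n → Fin r) (started : Fin r → Bool) →
                      length (suffixFamily n π started) ≡ ∏ (traceCount π started)
length-suffixFamily zero π started = sym (∏-ones traceCount≡1)
  where
  traceCount≡1 : ∀ i → traceCount π started i ≡ 1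
  traceCount≡1 i with started i
  ... | true  = refl
  ... | false = refl
length-suffixFamily {r = r} (suc n) π started with started (π zero) in started-π0
... | true = begin
  length (map (inside ∷_) rest)        ≡⟨ length-map {B = Subset (suc n)} (inside ∷_) rest ⟩
  length rest                          ≡⟨ length-suffixFamily n (π ∘ suc) started ⟩
  ∏ (traceCount (π ∘ suc) started)     ≡⟨ ∏-cong tail≡ ⟩
  ∏ (traceCount π started)             ∎
  where
  open ≡-Reasoning
  rest : List (Subset n)
  rest = suffixFamily n (π ∘ suc) started
  tail≡ : ∀ i → traceCount (π ∘ suc) started i ≡ traceCount π started i
  tail≡ i with i ≟ π zero
  ... | yes refl rewrite started-π0 = refl
  ... | no i≢π0 = traceCount-tail π started i≢π0
... | false = begin
  length (map (outside ∷_) rest ++ map (inside ∷_) rest′)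
    ≡⟨ length-++ (map (outside ∷_) rest) ⟩
  length (map (outside ∷_) rest) + length (map (inside ∷_) rest′)
    ≡⟨ cong₂ _+_ (length-map {B = Subset (suc n)} (outside ∷_) rest)
                 (length-map {B = Subset (suc n)} (inside ∷_) rest′) ⟩
  length rest + length rest′
    ≡⟨ cong₂ _+_ (length-suffixFamily n (π ∘ suc) started) (length-suffixFamily n (π ∘ suc) started′) ⟩
  ∏ (traceCount (π ∘ suc) started) + ∏ (traceCount (π ∘ suc) started′)
    ≡⟨ ∏-additive (π zero) at-π0 elsewhere ⟨
  ∏ (traceCount π started)
    ∎
  where
  open ≡-Reasoning
  started′ : Fin r → Bool
  started′ = start started (π zero)
  rest rest′ : List (Subset n)
  rest  = suffixFamily n (π ∘ suc) started
  rest′ = suffixFamily n (π ∘ suc) started′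
  a : ℕ
  a = ∣ part (π ∘ suc) (π zero) ∣
  at-π0 : traceCount π started (π zero) ≡
          traceCount (π ∘ suc) started (π zero) + traceCount (π ∘ suc) started′ (π zero)
  at-π0 = begin
    traceCount π started (π zero)   ≡⟨ cong (λ b → if b then 1 else ∣ part π (π zero) ∣ + 1) started-π0 ⟩
    ∣ part π (π zero) ∣ + 1         ≡⟨ cong (_+ 1) (∣part∣-head π) ⟩
    1 + (a + 1)                     ≡⟨ +-comm 1 (a + 1) ⟩
    (a + 1) + 1                     ≡⟨ cong₂ _+_ (cong (λ b → if b then 1 else a + 1) started-π0)
                                                 (cong (λ b → if b then 1 else a + 1) (updateAt-updates (π zero) started)) ⟨
    traceCount (π ∘ suc) started (π zero) + traceCount (π ∘ suc) started′ (π zero) ∎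
  elsewhere : ∀ i → i ≢ π zero →
              traceCount (π ∘ suc) started i ≡ traceCount π started i ×
              traceCount (π ∘ suc) started′ i ≡ traceCount π started i
  elsewhere i i≢π0 =
    traceCount-tail π started i≢π0 ,
    trans (cong (λ b → if b then 1 else ∣ part (π ∘ suc) i ∣ + 1) (updateAt-minimal i (π zero) started i≢π0))
          (traceCount-tail π started i≢π0)

enumerate : (p : Subset n) → Fin ∣ p ∣ → Fin n
enumerate (inside  ∷ p) zero    = zero
enumerate (inside  ∷ p) (suc j) = suc (enumerate p j)
enumerate (outside ∷ p) j       = suc (enumerate p j)

enumerate-∈ : (p : Subset n) (j : Fin ∣ p ∣) → enumerate p j ∈ₛ p
enumerate-∈ (inside  ∷ p) zero    = here
enumerate-∈ (inside  ∷ p) (suc j) = there (enumerate-∈ p j)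
enumerate-∈ (outside ∷ p) j       = there (enumerate-∈ p j)

enumerate-mono-< : (p : Subset n) {i j : Fin ∣ p ∣} → i Fin.< j → enumerate p i Fin.< enumerate p j
enumerate-mono-< (inside  ∷ p) {zero}  {suc j} _         = s≤s z≤n
enumerate-mono-< (inside  ∷ p) {suc i} {suc j} (s≤s i<j) = s≤s (enumerate-mono-< p i<j)
enumerate-mono-< (outside ∷ p)                 i<j       = s≤s (enumerate-mono-< p i<j)

upClosed-¬separable : ∀ {m} (π : Fin n → Fin (suc m)) (𝓕 : List (Subset n)) →
                      (∀ {F} → F ∈ 𝓕 → UpClosed π F) → ¬ Separable (2 + m) 𝓕
upClosed-¬separable {m = m} π 𝓕 upClosed (T , ∣T∣≡2+m , separates) =
  let i , j , i<j , πx≡πy = pigeonhole 1+m<∣T∣ (π ∘ enumerate T)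
      x<y                 = enumerate-mono-< T i<j
      F , F∈𝓕 , x∈F , y∉F = separates _ _ (enumerate-∈ T i) (enumerate-∈ T j) (<⇒≢ x<y)
  in  y∉F (upClosed F∈𝓕 x<y πx≡πy x∈F)
  where
  1+m<∣T∣ : suc m < ∣ T ∣
  1+m<∣T∣ = subst (suc m <_) (sym ∣T∣≡2+m) (n<1+n (suc m))

partProduct≡∏ : (π : Fin n → Fin r) → partProduct π ≡ ∏ (λ i → ∣ part π i ∣ + 1)
partProduct≡∏ π = cong product (map-tabulate id (λ i → ∣ part π i ∣ + 1))

partProduct<s : ∀ {m s} (π : Fin n → Fin (suc m)) → IsS n (2 + m) s → partProduct π < s
partProduct<s {n} π (allSeparable , _) = ≰⇒> λ s≤∏ →
  upClosed-¬separable π family (proj₁ ∘ suffixFamily-shape n π (const false))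
    (allSeparable family (suffixFamily-unique n π (const false)) (≤-trans s≤∏ (≤-reflexive ∏≡length)))
  where
  family : List (Subset n)
  family = suffixFamily n π (const false)
  ∏≡length : partProduct π ≡ length family
  ∏≡length = trans (partProduct≡∏ π) (sym (length-suffixFamily n π (const false)))

partProduct-bound : ∀ {m} (π : Fin n → Fin (suc m)) → (∀ i → n / suc m ≤ ∣ part π i ∣) →
                    n ^ suc m < partProduct π * suc m ^ suc m
partProduct-bound {n} {m} π large =
  subst (λ P → n ^ suc m < P * suc m ^ suc m) (sym (partProduct≡∏ π))
        (^<∏*^ (λ i → ∣ part π i ∣ + 1) (λ i → m/n≤o⇒m<[o+1]*n n (suc m) (large i)))

fromList : List (Fin n) → Subset n
fromList = foldr (λ x p → ⁅ x ⁆ ∪ p) ⊥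

∈-fromList⁻ : {x : Fin n} {xs : List (Fin n)} → x ∈ₛ fromList xs → x ∈ xs
∈-fromList⁻ {xs = []}     x∈ = ⊥-elim (∉⊥ x∈)
∈-fromList⁻ {xs = y ∷ xs} x∈ with x∈p∪q⁻ ⁅ y ⁆ (fromList xs) x∈
... | inj₁ x∈⁅y⁆ = here (x∈⁅y⁆⇒x≡y y x∈⁅y⁆)
... | inj₂ x∈xs  = there (∈-fromList⁻ x∈xs)

x∉p⇒∣⁅x⁆∪p∣≡1+∣p∣ : {x : Fin n} {p : Subset n} → x ∉ₛ p → ∣ ⁅ x ⁆ ∪ p ∣ ≡ suc ∣ p ∣
x∉p⇒∣⁅x⁆∪p∣≡1+∣p∣ {x = zero}  {outside ∷ p} _   = cong (suc ∘ ∣_∣) (∪-identityˡ p)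
x∉p⇒∣⁅x⁆∪p∣≡1+∣p∣ {x = zero}  {inside  ∷ p} x∉p = ⊥-elim (x∉p here)
x∉p⇒∣⁅x⁆∪p∣≡1+∣p∣ {x = suc x} {inside  ∷ p} x∉p = cong suc (x∉p⇒∣⁅x⁆∪p∣≡1+∣p∣ (x∉p ∘ there))
x∉p⇒∣⁅x⁆∪p∣≡1+∣p∣ {x = suc x} {outside ∷ p} x∉p = x∉p⇒∣⁅x⁆∪p∣≡1+∣p∣ (x∉p ∘ there)

∣fromList∣≡length : {xs : List (Fin n)} → Unique xs → ∣ fromList xs ∣ ≡ length xs
∣fromList∣≡length {n} {[]}     _      = ∣⊥∣≡0 n
∣fromList∣≡length {xs = x ∷ xs} unique@(_ ∷ unique′) =
  trans (x∉p⇒∣⁅x⁆∪p∣≡1+∣p∣ (Unique[x∷xs]⇒x∉xs unique ∘ ∈-fromList⁻)) (cong suc (∣fromList∣≡length unique′))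

unique⇒length≤∣p∣ : {xs : List (Fin n)} {p : Subset n} → Unique xs → (∀ {x} → x ∈ xs → x ∈ₛ p) → length xs ≤ ∣ p ∣
unique⇒length≤∣p∣ {p = p} unique xs⊆p =
  subst (_≤ ∣ p ∣) (∣fromList∣≡length unique) (p⊆q⇒∣p∣≤∣q∣ (xs⊆p ∘ ∈-fromList⁻))

∈-part⁺ : (π : Fin n → Fin r) {i : Fin r} {x : Fin n} → π x ≡ i → x ∈ₛ part π i
∈-part⁺ π {i} {x} πx≡i = lookup⇒[]= x (part π i) (trans (lookup∘tabulate _ x) (decide (π x ≟ i)))
  where
  decide : (d : Dec (π x ≡ i)) → ⌊ d ⌋ ≡ true
  decide (yes _)   = refl
  decide (no πx≢i) = ⊥-elim (πx≢i πx≡i)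

residue : (d : ℕ) .{{_ : NonZero d}} → Fin n → Fin d
residue d x = toℕ x mod d

-- Part i contains i, i + d, …, i + (⌊n/d⌋ − 1)·d.
∣part-residue∣≥ : (d : ℕ) .{{_ : NonZero d}} (i : Fin d) → n / d ≤ ∣ part (residue {n} d) i ∣
∣part-residue∣≥ {n} d i =
  subst (_≤ ∣ part π i ∣) (length-tabulate member)
        (unique⇒length≤∣p∣ {p = part π i} (tabulate⁺ member-injective) member∈part)
  where
  π : Fin n → Fin d
  π = residue d
  member-bound : (j : Fin (n / d)) → toℕ i + toℕ j * d < n
  member-bound j = begin-strict
    toℕ i + toℕ j * d <⟨ +-monoˡ-< (toℕ j * d) (toℕ<n i) ⟩
    d + toℕ j * d     ≤⟨ *-monoˡ-≤ d (toℕ<n j) ⟩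
    (n / d) * d       ≤⟨ m/n*n≤m n d ⟩
    n                 ∎
    where open ≤-Reasoning
  member : Fin (n / d) → Fin n
  member j = fromℕ< (member-bound j)
  member-injective : ∀ {j k} → member j ≡ member k → j ≡ k
  member-injective {j} {k} eq = toℕ-injective (*-cancelʳ-≡ (toℕ j) (toℕ k) d (+-cancelˡ-≡ (toℕ i) _ _
    (trans (sym (toℕ-fromℕ< (member-bound j))) (trans (cong toℕ eq) (toℕ-fromℕ< (member-bound k))))))
  member∈part : ∀ {x} → x ∈ tabulate member → x ∈ₛ part π i
  member∈part x∈ with ∈-tabulate⁻ x∈
  ... | j , refl = ∈-part⁺ π (toℕ-injective (begin
    toℕ (π (member j))          ≡⟨ toℕ-fromℕ< _ ⟩
    toℕ (member j) % d          ≡⟨ cong (_% d) (toℕ-fromℕ< (member-bound j)) ⟩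
    (toℕ i + toℕ j * d) % d     ≡⟨ [m+kn]%n≡m%n (toℕ i) (toℕ j) d ⟩
    toℕ i % d                   ≡⟨ m<n⇒m%n≡m (toℕ<n i) ⟩
    toℕ i                       ∎))
    where open ≡-Reasoning

length-cartesianProductWith : ∀ {A B C : Set} (f : A → B → C) (xs : List A) (ys : List B) →
                              length (cartesianProductWith f xs ys) ≡ length xs * length ys
length-cartesianProductWith f []       ys = refl
length-cartesianProductWith f (x ∷ xs) ys = begin
  length (map (f x) ys ++ cartesianProductWith f xs ys)        ≡⟨ length-++ (map (f x) ys) ⟩
  length (map (f x) ys) + length (cartesianProductWith f xs ys) ≡⟨ cong₂ _+_ (length-map (f x) ys)
                                                                             (length-cartesianProductWith f xs ys) ⟩
  length ys + length xs * length ys                            ∎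
  where open ≡-Reasoning

shatters⇒separable : ∀ {k} {𝓕 : List (Subset n)} → Shatters k 𝓕 → Separable (2 * k) 𝓕
shatters⇒separable {n} {k} {𝓕} (f , f-injective , snakes) = fromList matched , ∣matched∣≡2k , separates
  where
  sides : List Bool
  sides = false ∷ true ∷ []
  matched : List (Fin n)
  matched = cartesianProductWith f (allFin k) sides
  matched-unique : Unique matched
  matched-unique = cartesianProductWith⁺ f (f-injective _ _ _ _) (allFin⁺ k) (((λ ()) ∷ []) ∷ [] ∷ [])
  ∣matched∣≡2k : ∣ fromList matched ∣ ≡ 2 * k
  ∣matched∣≡2k = begin
    ∣ fromList matched ∣  ≡⟨ ∣fromList∣≡length matched-unique ⟩
    length matched        ≡⟨ length-cartesianProductWith f (allFin k) sides ⟩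
    length (allFin k) * 2 ≡⟨ cong (_* 2) (length-tabulate {n = k} id) ⟩
    k * 2                 ≡⟨ *-comm k 2 ⟩
    2 * k                 ∎
    where open ≡-Reasoning
  separates-pair : ∀ i b j c → f i b ≢ f j c → Σ (Subset n) λ F → F ∈ 𝓕 × f i b ∈ₛ F × f j c ∉ₛ F
  separates-pair i b j c fib≢fjc =
    let F , F∈𝓕 , traces = snakes snake in
    F , F∈𝓕 , proj₁ (traces i b) (sym snake-i) , proj₂ (traces j c) c≢snake-j
    where
    snake : Fin k → Bool
    snake = updateAt (const (not c)) i (const b)
    snake-i : snake i ≡ b
    snake-i = updateAt-updates i (const (not c))
    c≢snake-j : c ≢ snake j
    c≢snake-j with j ≟ i
    ... | yes refl = λ c≡snake-i → fib≢fjc (cong (f i) (trans (sym snake-i) (sym c≡snake-i)))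
    ... | no j≢i   = λ c≡snake-j → not-¬ refl (trans c≡snake-j (updateAt-minimal j i (const (not c)) j≢i))
  separates : ∀ x y → x ∈ₛ fromList matched → y ∈ₛ fromList matched → x ≢ y →
              Σ (Subset n) λ F → F ∈ 𝓕 × x ∈ₛ F × y ∉ₛ F
  separates x y x∈ y∈ x≢y
    with ∈-cartesianProductWith⁻ f (allFin k) sides (∈-fromList⁻ x∈)
       | ∈-cartesianProductWith⁻ f (allFin k) sides (∈-fromList⁻ y∈)
  ... | i , b , _ , _ , refl | j , c , _ , _ , refl = separates-pair i b j c x≢y

s≤p : ∀ {k s p} → IsS n (2 * k) s → IsP n k p → s ≤ p
s≤p (_ , s-least) (allShatter , _) = s-least _ λ 𝓕 unique large → shatters⇒separable (allShatter 𝓕 unique large)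

power<s : ∀ {t s} → 2 ≤ t → IsS n t s → n ^ (t ∸ 1) < s * (t ∸ 1) ^ (t ∸ 1)
power<s {n} {suc (suc m)} (s≤s (s≤s _)) isS =
  <-≤-trans (partProduct-bound π (∣part-residue∣≥ {n} (suc m)))
            (*-monoˡ-≤ (suc m ^ suc m) (<⇒≤ (partProduct<s π isS)))
  where
  π : Fin n → Fin (suc m)
  π = residue (suc m)

corollary11 :
    ((n m : ℕ) → 2 + m ≤ n → (π : Fin n → Fin (suc m)) →
      ((i : Fin (suc m)) →
        (∣ part π i ∣ ≡ n / suc m) ⊎ (∣ part π i ∣ ≡ ⌈ n /suc m ⌉)) →
      ((s : ℕ) → IsS n (2 + m) s → partProduct π < s) ×
      (n ^ suc m < partProduct π * suc m ^ suc m))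
    ×
    ((n k : ℕ) → 1 ≤ k → 2 * k ≤ n → (s p : ℕ) →
      IsS n (2 * k) s → IsP n k p →
      (s ≤ p) × (n ^ (2 * k ∸ 1) < s * (2 * k ∸ 1) ^ (2 * k ∸ 1)))
-- Neither bound needs n ≥ t: the constructions work for every n.
corollary11 =
  (λ n m _ π balanced → (λ s → partProduct<s π) , partProduct-bound π (λ i → ⌊/⌋≤ n m (balanced i))) ,
  (λ n k 1≤k _ s p isS isP → s≤p isS isP , power<s (*-monoʳ-≤ 2 1≤k) isS)
  where
  ⌊/⌋≤ : ∀ n m {x} → (x ≡ n / suc m) ⊎ (x ≡ ⌈ n /suc m ⌉) → n / suc m ≤ x
  ⌊/⌋≤ n m (inj₁ refl) = ≤-refl
  ⌊/⌋≤ n m (inj₂ refl) = /-monoˡ-≤ (suc m) (m≤m+n n m)
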